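{- Let $n\geq 3$ and let $t$ be the $n$-dimensional tarai function on $\mathbb{Z}^n$. For every $\vec{x}\in\mathbb{Z}^n$, the evaluation of $t(\vec{x})$ terminates with call-by-need, and $t(\vec{x})\leq\max(\vec{x})$, where $\max(\vec{x})=\max\{\vec{x}(1),\ldots,\vec{x}(n)\}$.
   Context: For $\vec{x}=\langle x_1,\ldots,x_n\rangle\in\mathbb{Z}^n$ write $\vec{x}(i)=x_i$, $\sigma(\vec{x})=\langle x_1-1,x_2,\ldots,x_n\rangle$ and $r(\vec{x})=\langle x_2,x_3,\ldots,x_n,x_1\rangle$. The $n$-dimensional tarai function $t$ is defined by the recursion: if $\vec{x}(1)\leq\vec{x}(2)$ then $t(\vec{x})=\vec{x}(2)$; otherwise $t(\vec{x})=t(\vec{y})$ where $\vec{y}(i)=t(\sigma(r^{i-1}(\vec{x})))$ for $i=1,\ldots,n$. Evaluation with call-by-need means: the arguments $\vec{y}(i)$ of the outer call are passed unevaluated (as delayed computations), and each is evaluated (at most once) only when its value is actually needed by the computation (e.g. compared in the test $\vec{y}(1)\leq\vec{y}(2)$ or returned); arguments whose values are never needed are never evaluated. "Terminates" means this evaluation process is finite. -}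

module Defs where

-- Call-by-need (lazy, with sharing) big-step semantics of the
-- n-dimensional tarai function, for n = 2 + k (so indices 1 and 2 exist).
-- Forcing a thunk evaluates it and overwrites it with its value
-- (so every delayed argument is evaluated at most once).

open import Data.Nat as ℕ using (ℕ; zero; suc; _∸_; _≡ᵇ_)
open import Data.Nat.DivMod using (_mod_)
open import Data.Fin using (Fin; zero; suc; toℕ; fromℕ<)
open import Data.Integer as ℤ using (ℤ; _⊔_; _≤_; _<_; _-_; 1ℤ; 0ℤ)
open import Data.Bool using (if_then_else_)
open import Relation.Nullary using (yes; no)
open import Relation.Binary.PropositionalEquality using (_≡_)

maxv : ∀ {m} → (Fin (suc m) → ℤ) → ℤ
maxv {zero} x = x zero
maxv {suc m} x = x zero ⊔ maxv (λ i → x (suc i))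

module Tarai (k : ℕ) where

  n : ℕ
  n = suc (suc k)

  data Thunk : Set where
    val  : ℤ → Thunk
    dec  : ℕ → Thunk               -- (value at address a) - 1
    call : (Fin n → ℕ) → Thunk      -- t applied to the thunks at the given addresses

  record Heap : Set where
    constructor heap
    field
      next : ℕ             -- first free address
      cell : ℕ → Thunk

  open Heap public

  -- index (i + j) mod n ; so  (r^i x)(j) = x (rotIdx i j)   (0-based)
  rotIdx : Fin n → Fin n → Fin n
  rotIdx i j = (toℕ i ℕ.+ toℕ j) mod n

  update : Heap → ℕ → Thunk → Heap
  update (heap nx c) a th = heap nx (λ b → if b ≡ᵇ a then th else c b)

  block : ℕ → (Fin n → Thunk) → (ℕ → Thunk) → ℕ → Thunk
  block p f c b with p ℕ.≤? b
  ... | no _ = c b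
  ... | yes _ with (b ∸ p) ℕ.<? n
  ...   | yes q = f (fromℕ< q)
  ...   | no _ = c b

  -- y(i) = t(σ(r^i x)) (0-based i): first argument is the fresh thunk
  -- x(i) - 1 stored at p + i, the j-th argument (j ≥ 1) is x((i+j) mod n)
  callArgs : ℕ → (Fin n → ℕ) → Fin n → Fin n → ℕ
  callArgs p bs i zero = p ℕ.+ toℕ i
  callArgs p bs i (suc j) = bs (rotIdx i (suc j))

  outerAddr : Heap → ℕ
  outerAddr Γ = next Γ ℕ.+ n ℕ.+ n

  -- allocate the thunks x(i)-1 (at p+i), y(i) (at p+n+i), and t(y) (at p+2n)
  expand : Heap → (Fin n → ℕ) → Heap
  expand Γ@(heap p c) bs = heap (suc (outerAddr Γ)) cell'
    where
    cell' : ℕ → Thunk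
    cell' b = if b ≡ᵇ outerAddr Γ
              then call (λ i → p ℕ.+ n ℕ.+ toℕ i)
              else block p (λ i → dec (bs i))
                     (block (p ℕ.+ n) (λ i → call (callArgs p bs i)) c) b

  i₁ i₂ : Fin n
  i₁ = zero
  i₂ = suc zero

  -- Γ ⊢ a ⇓ v ⊣ Δ : forcing the thunk at address a in heap Γ terminates
  -- with value v and final heap Δ (a finite derivation = finite evaluation)
  data _⊢_⇓_⊣_ : Heap → ℕ → ℤ → Heap → Set where
    ⇓val : ∀ {Γ a v} → cell Γ a ≡ val v → Γ ⊢ a ⇓ v ⊣ Γ
    ⇓dec : ∀ {Γ Δ a b v} → cell Γ a ≡ dec b → Γ ⊢ b ⇓ v ⊣ Δ →
           Γ ⊢ a ⇓ (v - 1ℤ) ⊣ update Δ a (val (v - 1ℤ))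
    ⇓le  : ∀ {Γ Γ₁ Γ₂ a bs u w} → cell Γ a ≡ call bs →
           Γ ⊢ bs i₁ ⇓ u ⊣ Γ₁ → Γ₁ ⊢ bs i₂ ⇓ w ⊣ Γ₂ → u ≤ w →
           Γ ⊢ a ⇓ w ⊣ update Γ₂ a (val w)
    ⇓gt  : ∀ {Γ Γ₁ Γ₂ Δ a bs u w v} → cell Γ a ≡ call bs →
           Γ ⊢ bs i₁ ⇓ u ⊣ Γ₁ → Γ₁ ⊢ bs i₂ ⇓ w ⊣ Γ₂ → w < u →
           expand Γ₂ bs ⊢ outerAddr Γ₂ ⇓ v ⊣ Δ →
           Γ ⊢ a ⇓ v ⊣ update Δ a (val v)

  rootAddr : ℕ
  rootAddr = n

  initHeap : (Fin n → ℤ) → Heap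
  initHeap x = heap (suc n) c
    where
    c : ℕ → Thunk
    c b = if b ≡ᵇ n then call (λ i → toℕ i) else block 0 (λ i → val (x i)) (λ _ → val 0ℤ) b

-- Let run w be the length of the strictly decreasing run w(0) > w(1) > … at the start of the
-- cyclic sequence w, so run w < n.  A call t(w) only ever forces its arguments 0, …, run w + 1, and
-- when w(1) < w(0) the vector y, y(j) = t(σ(r^j w)), of the recursive call t(y) has run y < run w:
-- y(run w) = w(run w + 1), while y(run w − 1) ≤ w(run w + 1) because t(v) ≤ v(2) whenever
-- v(1) ≤ v(2) (here n ≥ 3 is used).  The argument σ(w) of y(0) has no longer run and a smaller gap
-- w(0) − w(1), and σ(r^j w) for 0 < j ≤ run w has a shorter run.  Recursion on (run, gap),
-- lexicographically and through the needed arguments only, therefore defines t as a total function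
-- on ℤⁿ bounded by the maximum.  Evaluation keeps every heap cell denoting its value under this t,
-- and the same measure bounds the call-by-need evaluation.

module Submission where

open import Data.Bool using (if_then_else_)
open import Data.Empty using (⊥-elim)
open import Data.Fin using (Fin; zero; suc; toℕ; fromℕ<)
import Data.Fin.Properties as Finₚ
open import Data.Integer as ℤ using (ℤ; _-_; 1ℤ; 0ℤ; ∣_∣)
import Data.Integer.Properties as ℤₚ
open import Data.Integer.Tactic.RingSolver using (solve-∀)
open import Data.Nat as ℕ using (ℕ; zero; suc; _+_; _∸_; z≤n; s≤s; s≤s⁻¹; _≡ᵇ_)
import Data.Nat.Properties as ℕₚ
open import Data.Nat.DivMod using (_mod_; m%n≤m; m<n⇒m%n≡m; n%n≡0)
open import Data.Nat.Induction using (<-rec)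
open import Data.Product using (∃; ∃₂; _×_; _,_; proj₁; proj₂)
open import Data.Sum as Sum using (_⊎_; inj₁; inj₂)
open import Data.Vec.Functional using (_∷_)
open import Function using (_∘_)
open import Relation.Nullary using (¬_; does; yes; no)
open import Relation.Nullary.Decidable using (dec-true; dec-false)
open import Relation.Binary.PropositionalEquality

open import Defs

-- The orders of ℕ are opened only inside modules, so that _≤_ in theorem1p2 is the order of ℤ.
module _ where
  open import Data.Integer using (+_; +<+)
  open import Data.Nat using (_≤_; _<_)

  0<i⇒0<∣i∣ : ∀ {i} → 0ℤ ℤ.< i → 0 < ∣ i ∣
  0<i⇒0<∣i∣ {+ suc _} _ = s≤s z≤n
  0<i⇒0<∣i∣ {+ zero} (+<+ ())

  0<i⇒∣i-1∣<∣i∣ : ∀ {i} → 0ℤ ℤ.< i → ∣ i - 1ℤ ∣ < ∣ i ∣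
  0<i⇒∣i-1∣<∣i∣ {+ suc k} _ = ℕₚ.n<1+n k
  0<i⇒∣i-1∣<∣i∣ {+ zero} (+<+ ())

  i<j⇒0<j-i : ∀ {i j} → i ℤ.< j → 0ℤ ℤ.< j - i
  i<j⇒0<j-i {i} {j} i<j = subst (ℤ._< j - i) (ℤₚ.+-inverseʳ i) (ℤₚ.+-monoˡ-< (ℤ.- i) i<j)

  j<i⇒∣[i-1]-j∣<∣i-j∣ : ∀ {i j} → j ℤ.< i → ∣ (i - 1ℤ) - j ∣ < ∣ i - j ∣
  j<i⇒∣[i-1]-j∣<∣i-j∣ {i} {j} j<i =
    subst (λ k → ∣ k ∣ < ∣ i - j ∣) (sym (shuffle i j)) (0<i⇒∣i-1∣<∣i∣ (i<j⇒0<j-i j<i))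
    where
    shuffle : ∀ i j → (i - 1ℤ) - j ≡ (i - j) - 1ℤ
    shuffle = solve-∀

  ≤⊎> : ∀ i j → i ℤ.≤ j ⊎ j ℤ.< i
  ≤⊎> i j with i ℤ.≤? j
  ... | yes i≤j = inj₁ i≤j
  ... | no i≰j  = inj₂ (ℤₚ.≰⇒> i≰j)

  i-1≤i : ∀ i → i - 1ℤ ℤ.≤ i
  i-1≤i i = ℤₚ.i≤j⇒i-k≤j 1ℤ ℤₚ.≤-refl

  lookup≤maxv : ∀ {k} (x : Fin (suc k) → ℤ) i → x i ℤ.≤ maxv x
  lookup≤maxv {zero}  x zero    = ℤₚ.≤-refl
  lookup≤maxv {suc k} x zero    = ℤₚ.i≤i⊔j _ _
  lookup≤maxv {suc k} x (suc i) = ℤₚ.≤-trans (lookup≤maxv (x ∘ suc) i) (ℤₚ.i≤j⊔i _ _)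

  maxv-lub : ∀ {k} (x : Fin (suc k) → ℤ) {M} → (∀ i → x i ℤ.≤ M) → maxv x ℤ.≤ M
  maxv-lub {zero}  x x≤M = x≤M zero
  maxv-lub {suc k} x x≤M = ℤₚ.⊔-lub (x≤M zero) (maxv-lub (x ∘ suc) (x≤M ∘ suc))

  -- Initial descending runs

  descents : (ℕ → ℤ) → ℕ → ℕ
  descents f zero    = zero
  descents f (suc r) = if does (f 0 ℤ.≤? f 1) then zero else suc (descents (f ∘ suc) r)

  descents≤ : ∀ f r → descents f r ≤ r
  descents≤ f zero = z≤n
  descents≤ f (suc r) with f 0 ℤ.≤? f 1
  ... | yes _ = z≤n
  ... | no _  = s≤s (descents≤ (f ∘ suc) r)

  descents-pos : ∀ f r → f 1 ℤ.< f 0 → 0 < descents f (suc r)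
  descents-pos f r f₁<f₀ with f 0 ℤ.≤? f 1
  ... | yes f₀≤f₁ = ⊥-elim (ℤₚ.<⇒≱ f₁<f₀ f₀≤f₁)
  ... | no _      = s≤s z≤n

  descents-min : ∀ f r q → q < r → f q ℤ.≤ f (suc q) → descents f r ≤ q
  descents-min f (suc r) zero _ f₀≤f₁ with f 0 ℤ.≤? f 1
  ... | yes _  = z≤n
  ... | no f₀≰f₁ = ⊥-elim (f₀≰f₁ f₀≤f₁)
  descents-min f (suc r) (suc q) q<r fq≤fq+1 with f 0 ℤ.≤? f 1
  ... | yes _ = z≤n
  ... | no _  = s≤s (descents-min (f ∘ suc) r q (s≤s⁻¹ q<r) fq≤fq+1)

  descents-stop : ∀ f r → descents f r < r → f (descents f r) ℤ.≤ f (suc (descents f r))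
  descents-stop f (suc r) d<r with f 0 ℤ.≤? f 1
  ... | yes f₀≤f₁ = f₀≤f₁
  ... | no _      = descents-stop (f ∘ suc) r (s≤s⁻¹ d<r)

  descents-≤-head : ∀ (f : ℕ → ℤ) r → f (descents f r) ℤ.≤ f 0
  descents-≤-head f zero = ℤₚ.≤-refl
  descents-≤-head f (suc r) with f 0 ℤ.≤? f 1
  ... | yes _    = ℤₚ.≤-refl
  ... | no f₀≰f₁ =
    ℤₚ.≤-trans (descents-≤-head (f ∘ suc) r) (ℤₚ.<⇒≤ (ℤₚ.≰⇒> f₀≰f₁))

  descents-cong : ∀ f g r → (∀ q → q ≤ suc (descents f r) → f q ≡ g q) → descents g r ≡ descents f r
  descents-cong f g zero f≗g = refl
  descents-cong f g (suc r) f≗g with f 0 ℤ.≤? f 1 | g 0 ℤ.≤? g 1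
  ... | yes _     | yes _     = refl
  ... | no _      | no _      = cong suc (descents-cong (f ∘ suc) (g ∘ suc) r (λ q → f≗g (suc q) ∘ s≤s))
  ... | yes f₀≤f₁ | no g₀≰g₁  =
    ⊥-elim (g₀≰g₁ (subst₂ ℤ._≤_ (f≗g 0 z≤n) (f≗g 1 (s≤s z≤n)) f₀≤f₁))
  ... | no f₀≰f₁  | yes g₀≤g₁ =
    ⊥-elim (f₀≰f₁ (subst₂ ℤ._≤_ (sym (f≗g 0 z≤n)) (sym (f≗g 1 (s≤s z≤n))) g₀≤g₁))

  fuel-ind : ∀ (P : ℕ → ℕ → Set) → (∀ d → P zero d) → (∀ K → P (suc K) zero) →
             (∀ K d → P (suc K) d → (∀ d' → P K d') → P (suc K) (suc d)) →
             ∀ K d → P K d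
  fuel-ind P P₀ₓ Pₓ₀ step zero    d       = P₀ₓ d
  fuel-ind P P₀ₓ Pₓ₀ step (suc K) zero    = Pₓ₀ K
  fuel-ind P P₀ₓ Pₓ₀ step (suc K) (suc d) =
    step K d (fuel-ind P P₀ₓ Pₓ₀ step (suc K) d) (λ d' → fuel-ind P P₀ₓ Pₓ₀ step K d')

  if-≡ᵇ-refl : ∀ {A : Set} a {x y : A} → (if a ≡ᵇ a then x else y) ≡ x
  if-≡ᵇ-refl a {x} {y} = cong (if_then x else y) (dec-true (a ℕₚ.≟ a) refl)

  if-≡ᵇ-≢ : ∀ {A : Set} {a b} {x y : A} → ¬ a ≡ b → (if a ≡ᵇ b then x else y) ≡ y
  if-≡ᵇ-≢ {a = a} {b} {x} {y} a≢b = cong (if_then x else y) (dec-false (a ℕₚ.≟ b) a≢b)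

module TaraiFunction (m : ℕ) where
  open import Data.Nat using (_≤_; _<_)
  open Tarai (suc m) public

  ℤⁿ : Set
  ℤⁿ = Fin n → ℤ

  i₃ : Fin n
  i₃ = suc (suc zero)

  ix : ℕ → Fin n
  ix q = q mod n

  cyc : ℤⁿ → ℕ → ℤ
  cyc w q = w (ix q)

  toℕ-ix : ∀ {q} → q < n → toℕ (ix q) ≡ q
  toℕ-ix q<n = trans (Finₚ.toℕ-fromℕ< _) (m<n⇒m%n≡m q<n)

  toℕ-ix≤ : ∀ q → toℕ (ix q) ≤ q
  toℕ-ix≤ q = subst (_≤ q) (sym (Finₚ.toℕ-fromℕ< _)) (m%n≤m q n)

  ix-toℕ : ∀ j → ix (toℕ j) ≡ j
  ix-toℕ j = Finₚ.toℕ-injective (toℕ-ix (Finₚ.toℕ<n j))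

  ix-n : ix n ≡ zero
  ix-n = Finₚ.toℕ-injective (trans (Finₚ.toℕ-fromℕ< _) (n%n≡0 n))

  -- σr j w is σ(r^j(w)) with 0-based j, matching callArgs.
  σr : Fin n → ℤⁿ → ℤⁿ
  σr j w zero    = w j - 1ℤ
  σr j w (suc i) = w (rotIdx j (suc i))

  σr-cyc : ∀ j w {q} → suc q < n → cyc (σr j w) (suc q) ≡ cyc w (toℕ j + suc q)
  σr-cyc j w {q} q+1<n with ix (suc q) | toℕ-ix q+1<n
  ... | suc i | toℕi≡q = cong (λ p → cyc w (toℕ j + suc p)) (ℕₚ.suc-injective toℕi≡q)

  σr-cyc≤ : ∀ j w {q} → q < n → cyc (σr j w) q ℤ.≤ cyc w (toℕ j + q)
  σr-cyc≤ j w {zero} _ =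
    subst (w j - 1ℤ ℤ.≤_) (cong w (trans (sym (ix-toℕ j)) (cong ix (sym (ℕₚ.+-identityʳ (toℕ j))))))
          (i-1≤i (w j))
  σr-cyc≤ j w {suc q} q+1<n = ℤₚ.≤-reflexive (σr-cyc j w q+1<n)

  σr-i₂ : ∀ j w {q} → toℕ j ≡ q → σr j w i₂ ≡ cyc w (suc q)
  σr-i₂ j w {q} refl = cong (cyc w) (ℕₚ.+-comm q 1)

  σr-i₃ : ∀ j w {q} → toℕ j ≡ q → σr j w i₃ ≡ cyc w (suc (suc q))
  σr-i₃ j w {q} refl = cong (cyc w) (ℕₚ.+-comm q 2)

  σr≤maxv : ∀ j w i → σr j w i ℤ.≤ maxv w
  σr≤maxv j w zero    = ℤₚ.≤-trans (i-1≤i (w j)) (lookup≤maxv w j)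
  σr≤maxv j w (suc i) = lookup≤maxv w _

  -- A call with arguments w forces only the arguments 0, …, run w + 1.
  run : ℤⁿ → ℕ
  run w = descents (cyc w) (ℕ.pred n)

  run<n : ∀ w → run w < n
  run<n w = s≤s (descents≤ (cyc w) (ℕ.pred n))

  run-pos : ∀ w → w i₂ ℤ.< w i₁ → 0 < run w
  run-pos w = descents-pos (cyc w) (suc m)

  run-min : ∀ w {q} → suc q < n → cyc w q ℤ.≤ cyc w (suc q) → run w ≤ q
  run-min w q+1<n = descents-min (cyc w) (ℕ.pred n) _ (s≤s⁻¹ q+1<n)

  run-stop : ∀ w → cyc w (run w) ℤ.≤ cyc w (suc (run w))
  run-stop w with ℕₚ.m≤n⇒m<n∨m≡n (s≤s⁻¹ (run<n w))
  ... | inj₁ r<n-1 = descents-stop (cyc w) (ℕ.pred n) r<n-1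
  ... | inj₂ r≡n-1 =
    subst (λ q → cyc w (run w) ℤ.≤ w q) (trans (sym ix-n) (cong (ix ∘ suc) (sym r≡n-1)))
          (descents-≤-head (cyc w) (ℕ.pred n))

  run-cong : ∀ w w' → (∀ i → toℕ i ≤ suc (run w) → w i ≡ w' i) → run w' ≡ run w
  run-cong w w' w≗w' =
    descents-cong (cyc w) (cyc w') (ℕ.pred n) (λ q → w≗w' (ix q) ∘ ℕₚ.≤-trans (toℕ-ix≤ q))

  σr-stop : ∀ j w {q} → toℕ j + q ≡ run w → suc q < n → cyc (σr j w) q ℤ.≤ cyc (σr j w) (suc q)
  σr-stop j w {q} j+q≡r q+1<n = begin
    cyc (σr j w) q          ≤⟨ σr-cyc≤ j w (ℕₚ.<-trans (ℕₚ.n<1+n q) q+1<n) ⟩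
    cyc w (toℕ j + q)       ≡⟨ cong (cyc w) j+q≡r ⟩
    cyc w (run w)           ≤⟨ run-stop w ⟩
    cyc w (suc (run w))     ≡⟨ cong (cyc w) (trans (ℕₚ.+-suc (toℕ j) q) (cong suc j+q≡r)) ⟨
    cyc w (toℕ j + suc q)   ≡⟨ σr-cyc j w q+1<n ⟨
    cyc (σr j w) (suc q)    ∎
    where open ℤₚ.≤-Reasoning

  run-σr : ∀ j w → toℕ j ≤ run w → run (σr j w) + toℕ j ≤ run w
  run-σr j w j≤r = begin
    run (σr j w) + toℕ j     ≤⟨ ℕₚ.+-monoˡ-≤ (toℕ j) bound ⟩
    (run w ∸ toℕ j) + toℕ j  ≡⟨ ℕₚ.m∸n+n≡m j≤r ⟩
    run w                    ∎
    where
    open ℕₚ.≤-Reasoning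
    q = run w ∸ toℕ j
    j+q≡r : toℕ j + q ≡ run w
    j+q≡r = ℕₚ.m+[n∸m]≡n j≤r
    bound : run (σr j w) ≤ q
    bound with suc q ℕ.<? n
    ... | no q+1≮n  = ℕₚ.≤-trans (s≤s⁻¹ (run<n (σr j w))) (s≤s⁻¹ (ℕₚ.≮⇒≥ q+1≮n))
    ... | yes q+1<n = run-min (σr j w) q+1<n (σr-stop j w j+q≡r q+1<n)

  Agree : ℤⁿ → ℤⁿ → Set
  Agree w w' = ∀ i → toℕ i ≤ suc (run w) → w i ≡ w' i

  agree-refl : ∀ {w} → Agree w w
  agree-refl _ _ = refl

  agree-run : ∀ {w w'} → Agree w w' → run w' ≡ run w
  agree-run {w} {w'} = run-cong w w'

  rotIdx-needed : ∀ {j w} i → toℕ j ≤ run w → toℕ (suc i) ≤ suc (run (σr j w)) →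
                  toℕ (rotIdx j (suc i)) ≤ suc (run w)
  rotIdx-needed {j} {w} i j≤r i<r = begin
    toℕ (rotIdx j (suc i))        ≤⟨ toℕ-ix≤ _ ⟩
    toℕ j + suc (toℕ i)           ≡⟨ ℕₚ.+-suc (toℕ j) (toℕ i) ⟩
    suc (toℕ j + toℕ i)           ≤⟨ s≤s (ℕₚ.+-monoʳ-≤ (toℕ j) (s≤s⁻¹ i<r)) ⟩
    suc (toℕ j + run (σr j w))    ≡⟨ cong suc (ℕₚ.+-comm (toℕ j) _) ⟩
    suc (run (σr j w) + toℕ j)    ≤⟨ s≤s (run-σr j w j≤r) ⟩
    suc (run w)                   ∎
    where open ℕₚ.≤-Reasoning

  agree-σr : ∀ {w w'} j → Agree w w' → toℕ j ≤ run w → Agree (σr j w) (σr j w')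
  agree-σr j w≈w' j≤r zero    _   = cong (_- 1ℤ) (w≈w' j (ℕₚ.m≤n⇒m≤1+n j≤r))
  agree-σr j w≈w' j≤r (suc i) i<r = w≈w' (rotIdx j (suc i)) (rotIdx-needed i j≤r i<r)

  agree-< : ∀ {w w'} → Agree w w' → w i₂ ℤ.< w i₁ → w' i₂ ℤ.< w' i₁
  agree-< w≈w' = subst₂ ℤ._<_ (w≈w' i₂ (s≤s z≤n)) (w≈w' i₁ z≤n)

  gap : ℤⁿ → ℕ
  gap w = ∣ w i₁ - w i₂ ∣

  gap-pos : ∀ w → w i₂ ℤ.< w i₁ → 0 < gap w
  gap-pos w w₂<w₁ = 0<i⇒0<∣i∣ (i<j⇒0<j-i w₂<w₁)

  -- K bounds run w and d bounds gap w; the recursion is lexicographic in (K, d).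
  taraiF : ℕ → ℕ → ℤⁿ → ℤ
  taraiF zero    _       w = w i₂
  taraiF (suc K) zero    w = w i₂
  taraiF (suc K) (suc d) w =
    let y = taraiF (suc K) d (σr zero w) ∷ λ j → taraiF K (gap (σr (suc j) w)) (σr (suc j) w)
    in if does (w i₁ ℤ.≤? w i₂) then w i₂ else taraiF K (gap y) y

  -- The vector y of taraiF, which is inlined there for the termination checker.
  innerF : ℕ → ℕ → ℤⁿ → ℤⁿ
  innerF K d w = taraiF (suc K) d (σr zero w) ∷ λ j → taraiF K (gap (σr (suc j) w)) (σr (suc j) w)

  taraiF-≤ : ∀ K d w → w i₁ ℤ.≤ w i₂ → taraiF K d w ≡ w i₂
  taraiF-≤ zero    _       w _     = refl
  taraiF-≤ (suc K) zero    w _     = refl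
  taraiF-≤ (suc K) (suc d) w w₁≤w₂ =
    cong (if_then w i₂ else taraiF K (gap (innerF K d w)) (innerF K d w)) (dec-true (w i₁ ℤ.≤? w i₂) w₁≤w₂)

  taraiF-> : ∀ K d w → w i₂ ℤ.< w i₁ →
             taraiF (suc K) (suc d) w ≡ taraiF K (gap (innerF K d w)) (innerF K d w)
  taraiF-> K d w w₂<w₁ =
    cong (if_then w i₂ else taraiF K (gap (innerF K d w)) (innerF K d w))
         (dec-false (w i₁ ℤ.≤? w i₂) (ℤₚ.<⇒≱ w₂<w₁))

  taraiF≤maxv : ∀ K d w → taraiF K d w ℤ.≤ maxv w
  taraiF≤maxv = fuel-ind (λ K d → ∀ w → taraiF K d w ℤ.≤ maxv w)
                         (λ _ w → lookup≤maxv w i₂) (λ _ w → lookup≤maxv w i₂) step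
    where
    step : ∀ K d → (∀ w → taraiF (suc K) d w ℤ.≤ maxv w) →
           (∀ d' w → taraiF K d' w ℤ.≤ maxv w) → ∀ w → taraiF (suc K) (suc d) w ℤ.≤ maxv w
    step K d ih₀ ih w with ≤⊎> (w i₁) (w i₂)
    ... | inj₁ w₁≤w₂ =
      subst (ℤ._≤ maxv w) (sym (taraiF-≤ (suc K) (suc d) w w₁≤w₂)) (lookup≤maxv w i₂)
    ... | inj₂ w₂<w₁ = subst (ℤ._≤ maxv w) (sym (taraiF-> K d w w₂<w₁))
      (ℤₚ.≤-trans (ih _ (innerF K d w))
        (ℤₚ.⊔-lub (ℤₚ.≤-trans (ih₀ (σr zero w)) (maxv-lub _ (σr≤maxv zero w)))
                  (maxv-lub _ λ j → ℤₚ.≤-trans (ih (gap (σr (suc j) w)) (σr (suc j) w))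
                                                (maxv-lub _ (σr≤maxv (suc j) w)))))

  -- The only place where n ≥ 3 is used.
  taraiF≤i₃ : ∀ K d w → w i₂ ℤ.≤ w i₃ → taraiF K d w ℤ.≤ w i₃
  taraiF≤i₃ = fuel-ind (λ K d → ∀ w → w i₂ ℤ.≤ w i₃ → taraiF K d w ℤ.≤ w i₃)
                       (λ _ _ w₂≤w₃ → w₂≤w₃) (λ _ _ w₂≤w₃ → w₂≤w₃) step
    where
    step : ∀ K d → (∀ w → w i₂ ℤ.≤ w i₃ → taraiF (suc K) d w ℤ.≤ w i₃) →
           (∀ d' w → w i₂ ℤ.≤ w i₃ → taraiF K d' w ℤ.≤ w i₃) →
           ∀ w → w i₂ ℤ.≤ w i₃ → taraiF (suc K) (suc d) w ℤ.≤ w i₃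
    step K d ih₀ _ w w₂≤w₃ with ≤⊎> (w i₁) (w i₂)
    ... | inj₁ w₁≤w₂ = subst (ℤ._≤ w i₃) (sym (taraiF-≤ (suc K) (suc d) w w₁≤w₂)) w₂≤w₃
    ... | inj₂ w₂<w₁ = ℤₚ.≤-reflexive (begin
      taraiF (suc K) (suc d) w  ≡⟨ taraiF-> K d w w₂<w₁ ⟩
      taraiF K (gap y) y        ≡⟨ taraiF-≤ K _ y (ℤₚ.≤-trans y₁≤w₃ (ℤₚ.≤-reflexive (sym y₂≡w₃))) ⟩
      y i₂                      ≡⟨ y₂≡w₃ ⟩
      w i₃                      ∎)
      where
      open ≡-Reasoning
      y = innerF K d w
      y₁≤w₃ : y i₁ ℤ.≤ w i₃
      y₁≤w₃ = ih₀ (σr zero w) w₂≤w₃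
      y₂≡w₃ : y i₂ ≡ w i₃
      y₂≡w₃ = taraiF-≤ K _ (σr i₂ w) (ℤₚ.≤-trans (i-1≤i (w i₂)) w₂≤w₃)

  FuelledInner : ℤⁿ → ℤⁿ → Set
  FuelledInner w y = ∀ j → ∃₂ λ K d → y j ≡ taraiF K d (σr j w)

  innerF-fuelled : ∀ K d w → FuelledInner w (innerF K d w)
  innerF-fuelled K d w zero    = suc K , d , refl
  innerF-fuelled K d w (suc j) = K , _ , refl

  run-stop-at : ∀ w {k} → k ≡ run w → cyc w k ℤ.≤ cyc w (suc k)
  run-stop-at w k≡r = subst (λ k → cyc w k ℤ.≤ cyc w (suc k)) (sym k≡r) (run-stop w)

  fuelled-at-run : ∀ {w y k} → FuelledInner w y → k ≡ run w → y (ix k) ≡ cyc w (suc k)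
  fuelled-at-run {w} {y} {k} fy k≡r with fy (ix k)
  ... | K , d , yₖ≡ =
    trans yₖ≡ (trans (taraiF-≤ K d (σr (ix k) w) σ₁≤σ₂) (σr-i₂ (ix k) w toℕ-ixk))
    where
    toℕ-ixk : toℕ (ix k) ≡ k
    toℕ-ixk = toℕ-ix (subst (_< n) (sym k≡r) (run<n w))
    σ₁≤σ₂ : σr (ix k) w i₁ ℤ.≤ σr (ix k) w i₂
    σ₁≤σ₂ = ℤₚ.≤-trans (i-1≤i _)
                       (subst (cyc w k ℤ.≤_) (sym (σr-i₂ (ix k) w toℕ-ixk)) (run-stop-at w k≡r))

  fuelled-before-run : ∀ {w y k} → FuelledInner w y → suc k ≡ run w → y (ix k) ℤ.≤ cyc w (suc (suc k))
  fuelled-before-run {w} {y} {k} fy k+1≡r with fy (ix k)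
  ... | K , d , yₖ≡ =
    subst₂ ℤ._≤_ (sym yₖ≡) (σr-i₃ (ix k) w toℕ-ixk) (taraiF≤i₃ K d (σr (ix k) w) σ₂≤σ₃)
    where
    toℕ-ixk : toℕ (ix k) ≡ k
    toℕ-ixk = toℕ-ix (ℕₚ.<-trans (ℕₚ.n<1+n k) (subst (_< n) (sym k+1≡r) (run<n w)))
    σ₂≤σ₃ : σr (ix k) w i₂ ℤ.≤ σr (ix k) w i₃
    σ₂≤σ₃ = subst₂ ℤ._≤_ (sym (σr-i₂ (ix k) w toℕ-ixk)) (sym (σr-i₃ (ix k) w toℕ-ixk))
                         (run-stop-at w k+1≡r)

  run-fuelled< : ∀ {w y} → w i₂ ℤ.< w i₁ → FuelledInner w y → run y < run w
  run-fuelled< {w} {y} w₂<w₁ fy = go (run w) refl (run-pos w w₂<w₁)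
    where
    go : ∀ r → r ≡ run w → 0 < r → run y < r
    go (suc k) k+1≡r _ = s≤s (run-min y (subst (_< n) (sym k+1≡r) (run<n w))
      (ℤₚ.≤-trans (fuelled-before-run fy k+1≡r) (ℤₚ.≤-reflexive (sym (fuelled-at-run fy k+1≡r)))))

  agree-fuelled : ∀ {w y y'} → w i₂ ℤ.< w i₁ → FuelledInner w y →
                  (∀ j → toℕ j ≤ run w → y j ≡ y' j) → Agree y y'
  agree-fuelled w₂<w₁ fy y≗y' i i≤r = y≗y' i (ℕₚ.≤-trans i≤r (run-fuelled< w₂<w₁ fy))

  record Enough (K d : ℕ) (w : ℤⁿ) : Set where
    constructor enough
    field
      run≤ : run w ≤ K
      gap≤ : w i₂ ℤ.< w i₁ → gap w ≤ d
  open Enough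

  enough-self : ∀ w → Enough (run w) (gap w) w
  enough-self w = enough ℕₚ.≤-refl (λ _ → ℕₚ.≤-refl)

  enough-suc : ∀ {K d w} → Enough K d w → Enough (suc K) (suc d) w
  enough-suc (enough r≤K g≤d) = enough (ℕₚ.m≤n⇒m≤1+n r≤K) (ℕₚ.m≤n⇒m≤1+n ∘ g≤d)

  fuel-pred : ∀ {K d w} → Enough K d w → w i₂ ℤ.< w i₁ → ∃₂ λ K₀ d₀ → K ≡ suc K₀ × d ≡ suc d₀
  fuel-pred {suc K₀} {suc d₀} _ _ = K₀ , d₀ , refl , refl
  fuel-pred {zero}  {w = w} e w₂<w₁ =
    ⊥-elim (ℕₚ.n≮0 (ℕₚ.<-≤-trans (run-pos w w₂<w₁) (run≤ e)))
  fuel-pred {suc _} {zero} {w} e w₂<w₁ =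
    ⊥-elim (ℕₚ.n≮0 (ℕₚ.<-≤-trans (gap-pos w w₂<w₁) (gap≤ e w₂<w₁)))

  enough-≤ : ∀ {K d w} → Enough K d w → K ≡ 0 ⊎ d ≡ 0 → w i₁ ℤ.≤ w i₂
  enough-≤ {w = w} e K≡0⊎d≡0 with ≤⊎> (w i₁) (w i₂)
  ... | inj₁ w₁≤w₂ = w₁≤w₂
  ... | inj₂ w₂<w₁ with fuel-pred e w₂<w₁ | K≡0⊎d≡0
  ...   | _ , _ , refl , _ | inj₁ ()
  ...   | _ , _ , _ , refl | inj₂ ()

  enough-σr₀ : ∀ {K d w} → w i₂ ℤ.< w i₁ → Enough K (suc d) w → Enough K d (σr zero w)
  enough-σr₀ {w = w} w₂<w₁ (enough r≤K g≤d) = enough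
    (ℕₚ.≤-trans (ℕₚ.m≤m+n _ 0) (ℕₚ.≤-trans (run-σr zero w z≤n) r≤K))
    λ _ → s≤s⁻¹ (ℕₚ.<-≤-trans (j<i⇒∣[i-1]-j∣<∣i-j∣ w₂<w₁) (g≤d w₂<w₁))

  enough-σrₛ : ∀ {K d w} j → Enough (suc K) d w → toℕ (suc j) ≤ run w →
               Enough K (gap (σr (suc j) w)) (σr (suc j) w)
  enough-σrₛ {w = w} j e j<r = enough
    (s≤s⁻¹ (ℕₚ.<-≤-trans (ℕₚ.m<m+n _ (s≤s z≤n)) (ℕₚ.≤-trans (run-σr (suc j) w j<r) (run≤ e))))
    (λ _ → ℕₚ.≤-refl)

  enough-fuelled : ∀ {K w y} → w i₂ ℤ.< w i₁ → FuelledInner w y → run w ≤ suc K → Enough K (gap y) y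
  enough-fuelled w₂<w₁ fy r≤K =
    enough (s≤s⁻¹ (ℕₚ.<-≤-trans (run-fuelled< w₂<w₁ fy) r≤K)) (λ _ → ℕₚ.≤-refl)

  taraiF-≡-≤ : ∀ K d K' d' {w w'} → w i₁ ℤ.≤ w i₂ → Agree w w' → taraiF K d w ≡ taraiF K' d' w'
  taraiF-≡-≤ K d K' d' {w} {w'} w₁≤w₂ w≈w' = begin
    taraiF K d w    ≡⟨ taraiF-≤ K d w w₁≤w₂ ⟩
    w i₂            ≡⟨ w₂≡w'₂ ⟩
    w' i₂           ≡⟨ taraiF-≤ K' d' w' (subst₂ ℤ._≤_ (w≈w' i₁ z≤n) w₂≡w'₂ w₁≤w₂) ⟨
    taraiF K' d' w' ∎
    where
    open ≡-Reasoning
    w₂≡w'₂ : w i₂ ≡ w' i₂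
    w₂≡w'₂ = w≈w' i₂ (s≤s z≤n)

  taraiF-cong : ∀ K d K' d' {w w'} → Enough K d w → Enough K' d' w' → Agree w w' →
                taraiF K d w ≡ taraiF K' d' w'
  taraiF-cong = fuel-ind P (λ _ → out-of-fuel (inj₁ refl)) (λ _ → out-of-fuel (inj₂ refl)) step
    where
    P : ℕ → ℕ → Set
    P K d = ∀ K' d' {w w'} → Enough K d w → Enough K' d' w' → Agree w w' → taraiF K d w ≡ taraiF K' d' w'

    out-of-fuel : ∀ {K d} → K ≡ 0 ⊎ d ≡ 0 → P K d
    out-of-fuel {K} {d} K≡0⊎d≡0 K' d' e _ = taraiF-≡-≤ K d K' d' (enough-≤ e K≡0⊎d≡0)

    step : ∀ K d → P (suc K) d → (∀ d₀ → P K d₀) → P (suc K) (suc d)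
    step K d ih₀ ih K' d' {w} {w'} e e' w≈w' with ≤⊎> (w i₁) (w i₂)
    ... | inj₁ w₁≤w₂ = taraiF-≡-≤ (suc K) (suc d) K' d' w₁≤w₂ w≈w'
    ... | inj₂ w₂<w₁ with fuel-pred e' (agree-< w≈w' w₂<w₁)
    ...   | K₀' , d₀' , refl , refl = begin
      taraiF (suc K) (suc d) w       ≡⟨ taraiF-> K d w w₂<w₁ ⟩
      taraiF K (gap y) y             ≡⟨ ih _ K₀' _ (enough-fuelled w₂<w₁ (innerF-fuelled K d w) (run≤ e))
                                                   (enough-fuelled w'₂<w'₁ (innerF-fuelled K₀' d₀' w') (run≤ e'))
                                                   (agree-fuelled w₂<w₁ (innerF-fuelled K d w) y≗y') ⟩
      taraiF K₀' (gap y') y'         ≡⟨ taraiF-> K₀' d₀' w' w'₂<w'₁ ⟨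
      taraiF (suc K₀') (suc d₀') w'  ∎
      where
      open ≡-Reasoning
      y = innerF K d w
      y' = innerF K₀' d₀' w'
      w'₂<w'₁ : w' i₂ ℤ.< w' i₁
      w'₂<w'₁ = agree-< w≈w' w₂<w₁
      y≗y' : ∀ j → toℕ j ≤ run w → y j ≡ y' j
      y≗y' zero    _   = ih₀ (suc K₀') d₀' (enough-σr₀ w₂<w₁ e) (enough-σr₀ w'₂<w'₁ e')
                                           (agree-σr zero w≈w' z≤n)
      y≗y' (suc j) j<r = ih _ K₀' _ (enough-σrₛ j e j<r)
                                    (enough-σrₛ j e' (subst (_ ≤_) (sym (agree-run w≈w')) j<r))
                                    (agree-σr (suc j) w≈w' j<r)

  tarai : ℤⁿ → ℤ
  tarai w = taraiF (run w) (gap w) w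

  inner : ℤⁿ → ℤⁿ
  inner w j = tarai (σr j w)

  taraiF≡tarai : ∀ {K d w} → Enough K d w → taraiF K d w ≡ tarai w
  taraiF≡tarai {K} {d} {w} e = taraiF-cong K d _ _ e (enough-self w) agree-refl

  tarai-cong : ∀ {w w'} → (∀ i → w i ≡ w' i) → tarai w ≡ tarai w'
  tarai-cong {w} {w'} w≗w' = taraiF-cong _ _ _ _ (enough-self w) (enough-self w') (λ i _ → w≗w' i)

  tarai-≤ : ∀ w → w i₁ ℤ.≤ w i₂ → tarai w ≡ w i₂
  tarai-≤ w = taraiF-≤ (run w) (gap w) w

  tarai≤maxv : ∀ w → tarai w ℤ.≤ maxv w
  tarai≤maxv w = taraiF≤maxv (run w) (gap w) w

  inner-fuelled : ∀ w → FuelledInner w (inner w)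
  inner-fuelled w j = run (σr j w) , gap (σr j w) , refl

  run-inner< : ∀ w → w i₂ ℤ.< w i₁ → run (inner w) < run w
  run-inner< w w₂<w₁ = run-fuelled< w₂<w₁ (inner-fuelled w)

  tarai-> : ∀ w → w i₂ ℤ.< w i₁ → tarai w ≡ tarai (inner w)
  tarai-> w w₂<w₁ = begin
    tarai w                               ≡⟨ taraiF≡tarai e ⟨
    taraiF (suc (run w)) (suc (gap w)) w  ≡⟨ taraiF-> (run w) (gap w) w w₂<w₁ ⟩
    taraiF (run w) (gap y) y              ≡⟨ taraiF-cong _ _ _ _ (enough-fuelled w₂<w₁ y-fuelled (run≤ e))
                                                   (enough-self (inner w)) (agree-fuelled w₂<w₁ y-fuelled y≗inner) ⟩
    tarai (inner w)                       ∎
    where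
    open ≡-Reasoning
    e : Enough (suc (run w)) (suc (gap w)) w
    e = enough-suc (enough-self w)
    y = innerF (run w) (gap w) w
    y-fuelled : FuelledInner w y
    y-fuelled = innerF-fuelled (run w) (gap w) w
    y≗inner : ∀ j → toℕ j ≤ run w → y j ≡ inner w j
    y≗inner zero    _   = taraiF≡tarai (enough-σr₀ w₂<w₁ e)
    y≗inner (suc j) j<r = taraiF≡tarai (enough-σrₛ j e j<r)

  tarai-ind : (P : ℤⁿ → Set) →
              (∀ w → (w i₂ ℤ.< w i₁ → P (inner w) × (∀ j → toℕ j ≤ run w → P (σr j w))) → P w) →
              ∀ w → P w
  tarai-ind P step w =
    fuel-ind Q (λ _ → base (inj₁ refl)) (λ _ → base (inj₂ refl)) step′ _ _ w (enough-self w)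
    where
    Q : ℕ → ℕ → Set
    Q K d = ∀ w → Enough K d w → P w

    base : ∀ {K d} → K ≡ 0 ⊎ d ≡ 0 → Q K d
    base K≡0⊎d≡0 w e = step w (λ w₂<w₁ → ⊥-elim (ℤₚ.<⇒≱ w₂<w₁ (enough-≤ e K≡0⊎d≡0)))

    step′ : ∀ K d → Q (suc K) d → (∀ d₀ → Q K d₀) → Q (suc K) (suc d)
    step′ K d ih₀ ih w e = step w λ w₂<w₁ →
      ih _ (inner w) (enough-fuelled w₂<w₁ (inner-fuelled w) (run≤ e)) , λ where
        zero    _   → ih₀ (σr zero w) (enough-σr₀ w₂<w₁ e)
        (suc j) j<r → ih _ (σr (suc j) w) (enough-σrₛ j e j<r)

module CallByNeed (m : ℕ) where
  open import Data.Nat using (_≤_; _<_)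
  open import Data.Nat.Properties
    using (+-monoʳ-<; +-monoʳ-≤; <-trans; <-≤-trans; <⇒≢; <⇒≤; <⇒≱; m+[n∸m]≡n; m+n∸m≡n; m≤m+n;
           m≤n⇒m≤1+n; n<1+n; n≤1+n; ∸-monoˡ-≤; ≤-<-trans; ≤-antisym; ≤-refl; ≤-trans; ≤∧≢⇒<; ≮⇒≥)
  open TaraiFunction m

  -- block of Defs, with entries of any type.
  blk : {A : Set} → ℕ → (Fin n → A) → (ℕ → A) → ℕ → A
  blk p f c b with p ℕ.≤? b
  ... | no _ = c b
  ... | yes _ with (b ∸ p) ℕ.<? n
  ...   | yes q = f (fromℕ< q)
  ...   | no _  = c b

  block≡blk : ∀ {p f c c' b} → c b ≡ c' b → block p f c b ≡ blk p f c' b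
  block≡blk {p} {b = b} cb≡c'b with p ℕ.≤? b
  ... | no _ = cb≡c'b
  ... | yes _ with (b ∸ p) ℕ.<? n
  ...   | yes _ = refl
  ...   | no _  = cb≡c'b

  blk-below : ∀ {A : Set} p (f : Fin n → A) c {b} → b < p → blk p f c b ≡ c b
  blk-below p f c {b} b<p with p ℕ.≤? b
  ... | no _    = refl
  ... | yes p≤b = ⊥-elim (<⇒≱ b<p p≤b)

  blk-above : ∀ {A : Set} p (f : Fin n → A) c {b} → p + n ≤ b → blk p f c b ≡ c b
  blk-above p f c {b} p+n≤b with p ℕ.≤? b
  ... | no _ = refl
  ... | yes _ with (b ∸ p) ℕ.<? n
  ...   | no _    = refl
  ...   | yes b-p<n = ⊥-elim (<⇒≱ b-p<n (subst (_≤ b ∸ p) (m+n∸m≡n p n) (∸-monoˡ-≤ p p+n≤b)))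

  blk-at : ∀ {A : Set} p (f : Fin n → A) c i → blk p f c (p + toℕ i) ≡ f i
  blk-at p f c i with p ℕ.≤? p + toℕ i
  ... | no p≰p+i = ⊥-elim (p≰p+i (m≤m+n p (toℕ i)))
  ... | yes _ with (p + toℕ i ∸ p) ℕ.<? n
  ...   | yes q    = cong f (Finₚ.toℕ-injective (trans (Finₚ.toℕ-fromℕ< q) (m+n∸m≡n p (toℕ i))))
  ...   | no p+i-p≮n = ⊥-elim (p+i-p≮n (subst (_< n) (sym (m+n∸m≡n p (toℕ i))) (Finₚ.toℕ<n i)))

  block-split : ∀ p b → b < p ⊎ (∃ λ (i : Fin n) → b ≡ p + toℕ i) ⊎ p + n ≤ b
  block-split p b with b ℕ.<? p
  ... | yes b<p = inj₁ b<p
  ... | no b≮p with (b ∸ p) ℕ.<? n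
  ...   | yes b-p<n = inj₂ (inj₁ (fromℕ< b-p<n ,
            sym (trans (cong (p +_) (Finₚ.toℕ-fromℕ< b-p<n)) (m+[n∸m]≡n (≮⇒≥ b≮p)))))
  ...   | no b-p≮n =
    inj₂ (inj₂ (subst (p + n ≤_) (m+[n∸m]≡n (≮⇒≥ b≮p)) (+-monoʳ-≤ p (≮⇒≥ b-p≮n))))

  -- The store written by expand with p = next Γ: the thunks x(i) - 1 at p + i,
  -- y(j) at p + n + j, and the outer call t(y) at p + 2n.
  layout : {A : Set} → ℕ → (Fin n → A) → (Fin n → A) → A → (ℕ → A) → ℕ → A
  layout p f g o c b = if b ≡ᵇ p + n + n then o else blk p f (blk (p + n) g c) b

  module Layout {A : Set} (p : ℕ) (f g : Fin n → A) (o : A) (c : ℕ → A) where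
    layout-old : ∀ {b} → b < p → layout p f g o c b ≡ c b
    layout-old b<p = trans (if-≡ᵇ-≢ (<⇒≢ (<-≤-trans b<p (≤-trans (m≤m+n p n) (m≤m+n (p + n) n)))))
                           (trans (blk-below p f (blk (p + n) g c) b<p)
                                  (blk-below (p + n) g c (<-≤-trans b<p (m≤m+n p n))))

    layout-dec : ∀ i → layout p f g o c (p + toℕ i) ≡ f i
    layout-dec i = trans (if-≡ᵇ-≢ (<⇒≢ (<-≤-trans (+-monoʳ-< p (Finₚ.toℕ<n i)) (m≤m+n (p + n) n))))
                         (blk-at p f (blk (p + n) g c) i)

    layout-arg : ∀ j → layout p f g o c (p + n + toℕ j) ≡ g j
    layout-arg j = trans (if-≡ᵇ-≢ (<⇒≢ (+-monoʳ-< (p + n) (Finₚ.toℕ<n j))))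
                         (trans (blk-above p f (blk (p + n) g c) (m≤m+n (p + n) (toℕ j))) (blk-at (p + n) g c j))

    layout-outer : layout p f g o c (p + n + n) ≡ o
    layout-outer = if-≡ᵇ-refl (p + n + n)

  data Region (p b : ℕ) : Set where
    old   : b < p → Region p b
    decs  : ∀ (i : Fin n) → b ≡ p + toℕ i → Region p b
    args  : ∀ (j : Fin n) → b ≡ p + n + toℕ j → Region p b
    outer : b ≡ p + n + n → Region p b

  region : ∀ p {b} → b ≤ p + n + n → Region p b
  region p {b} b≤ with block-split p b
  ... | inj₁ b<p              = old b<p
  ... | inj₂ (inj₁ (i , b≡))  = decs i b≡
  ... | inj₂ (inj₂ p+n≤b) with block-split (p + n) b
  ...   | inj₁ b<p+n             = ⊥-elim (<⇒≱ b<p+n p+n≤b)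
  ...   | inj₂ (inj₁ (j , b≡))   = args j b≡
  ...   | inj₂ (inj₂ p+2n≤b)     = outer (≤-antisym b≤ p+2n≤b)

  expand-layout : ∀ Γ bs b → cell (expand Γ bs) b ≡
    layout (next Γ) (dec ∘ bs) (call ∘ callArgs (next Γ) bs) (call λ i → next Γ + n + toℕ i) (cell Γ) b
  expand-layout Γ bs b = cong (if b ≡ᵇ outerAddr Γ then _ else_)
    (block≡blk {next Γ} {dec ∘ bs} (block≡blk {next Γ + n} {call ∘ callArgs (next Γ) bs} {cell Γ} refl))

  -- Models of heaps

  Den : Set
  Den = ℕ → ℤ

  Denotes : Den → ℕ → Thunk → Set
  Denotes D a (val v)   = D a ≡ v
  Denotes D a (dec b)   = b < a × D a ≡ D b - 1ℤ
  Denotes D a (call bs) = (∀ i → bs i < a) × D a ≡ tarai (D ∘ bs)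

  _⊨_ : Den → Heap → Set
  D ⊨ Γ = ∀ a → a < next Γ → Denotes D a (cell Γ a)

  denotes : ∀ {D Γ a th} → D ⊨ Γ → a < next Γ → cell Γ a ≡ th → Denotes D a th
  denotes {D} {a = a} ⊨Γ a<next c≡ = subst (Denotes D a) c≡ (⊨Γ a a<next)

  call-args< : ∀ {D Γ a bs} → D ⊨ Γ → a < next Γ → cell Γ a ≡ call bs → ∀ i → bs i < next Γ
  call-args< ⊨Γ a< c≡ i = <-trans (proj₁ (denotes ⊨Γ a< c≡) i) a<

  denotes-mono : ∀ {D D' a} th → (∀ b → b ≤ a → D' b ≡ D b) → Denotes D a th → Denotes D' a th
  denotes-mono (val v)   D'≗D Da≡v = trans (D'≗D _ ≤-refl) Da≡v
  denotes-mono (dec b)   D'≗D (b<a , Da≡) =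
    b<a , trans (D'≗D _ ≤-refl) (trans Da≡ (cong (_- 1ℤ) (sym (D'≗D b (<⇒≤ b<a)))))
  denotes-mono (call bs) D'≗D (bs<a , Da≡) =
    bs<a , trans (D'≗D _ ≤-refl) (trans Da≡ (tarai-cong λ i → sym (D'≗D (bs i) (<⇒≤ (bs<a i)))))

  record Extends (Γ : Heap) (D : Den) (Γ' : Heap) (D' : Den) : Set where
    field
      models   : D' ⊨ Γ'
      next≤    : next Γ ≤ next Γ'
      den-old  : ∀ a → a < next Γ → D' a ≡ D a
      cell-old : ∀ a → a < next Γ → cell Γ' a ≡ cell Γ a ⊎ cell Γ' a ≡ val (D a)
  open Extends

  extends-refl : ∀ {Γ D} → D ⊨ Γ → Extends Γ D Γ D
  extends-refl ⊨Γ = record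
    { models = ⊨Γ ; next≤ = ≤-refl ; den-old = λ _ _ → refl ; cell-old = λ _ _ → inj₁ refl }

  extends-trans : ∀ {Γ D Γ' D' Γ'' D''} →
                  Extends Γ D Γ' D' → Extends Γ' D' Γ'' D'' → Extends Γ D Γ'' D''
  extends-trans {Γ} {D} {Γ'} {D'} {Γ''} {D''} ext ext' = record
    { models   = models ext'
    ; next≤    = ≤-trans (next≤ ext) (next≤ ext')
    ; den-old  = λ a a< → trans (den-old ext' a (lift a<)) (den-old ext a a<)
    ; cell-old = λ a a< → compose a a< (cell-old ext' a (lift a<)) (cell-old ext a a<)
    }
    where
    lift : ∀ {a} → a < next Γ → a < next Γ'
    lift a< = <-≤-trans a< (next≤ ext)
    compose : ∀ a → a < next Γ →
              cell Γ'' a ≡ cell Γ' a ⊎ cell Γ'' a ≡ val (D' a) →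
              cell Γ' a ≡ cell Γ a ⊎ cell Γ' a ≡ val (D a) →
              cell Γ'' a ≡ cell Γ a ⊎ cell Γ'' a ≡ val (D a)
    compose a a< (inj₁ c''≡c') (inj₁ c'≡c) = inj₁ (trans c''≡c' c'≡c)
    compose a a< (inj₁ c''≡c') (inj₂ c'≡v) = inj₂ (trans c''≡c' c'≡v)
    compose a a< (inj₂ c''≡v)  _           = inj₂ (trans c''≡v (cong val (den-old ext a a<)))

  extends-update : ∀ {Γ D Δ D' a v} → Extends Γ D Δ D' → a < next Γ → v ≡ D a →
                   Extends Γ D (update Δ a (val v)) D'
  extends-update {Γ} {D} {Δ} {D'} {a} {v} ext a< v≡Da = record
    { models   = models′
    ; next≤    = next≤ ext
    ; den-old  = den-old ext
    ; cell-old = cell-old′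
    }
    where
    models′ : D' ⊨ update Δ a (val v)
    models′ b b< with b ℕₚ.≟ a
    ... | yes refl = subst (Denotes D' b) (sym (if-≡ᵇ-refl b)) (trans (den-old ext b a<) (sym v≡Da))
    ... | no b≢a   = subst (Denotes D' b) (sym (if-≡ᵇ-≢ b≢a)) (models ext b b<)
    cell-old′ : ∀ b → b < next Γ →
                cell (update Δ a (val v)) b ≡ cell Γ b ⊎ cell (update Δ a (val v)) b ≡ val (D b)
    cell-old′ b b< with b ℕₚ.≟ a
    ... | yes refl = inj₂ (trans (if-≡ᵇ-refl b) (cong val v≡Da))
    ... | no b≢a   = Sum.map (trans (if-≡ᵇ-≢ b≢a)) (trans (if-≡ᵇ-≢ b≢a)) (cell-old ext b b<)

  expandDen : ℕ → Den → ℤⁿ → Den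
  expandDen p D w = layout p (λ i → w i - 1ℤ) (λ j → tarai (σr j w)) (tarai (inner w)) D

  module _ (p : ℕ) (D : Den) (w : ℤⁿ) where
    open Layout p (λ i → w i - 1ℤ) (λ j → tarai (σr j w)) (tarai (inner w)) D

    expandDen-old : ∀ {b} → b < p → expandDen p D w b ≡ D b
    expandDen-old = layout-old

    expandDen-dec : ∀ i → expandDen p D w (p + toℕ i) ≡ w i - 1ℤ
    expandDen-dec = layout-dec

    expandDen-arg : ∀ j → expandDen p D w (p + n + toℕ j) ≡ tarai (σr j w)
    expandDen-arg = layout-arg

    expandDen-outer : expandDen p D w (p + n + n) ≡ tarai (inner w)
    expandDen-outer = layout-outer

  module _ (Γ : Heap) (bs : Fin n → ℕ) where
    open Layout (next Γ) (dec ∘ bs) (call ∘ callArgs (next Γ) bs) (call λ i → next Γ + n + toℕ i)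
                (cell Γ)

    expand-old : ∀ {b} → b < next Γ → cell (expand Γ bs) b ≡ cell Γ b
    expand-old b<p = trans (expand-layout Γ bs _) (layout-old b<p)

    expand-dec : ∀ i → cell (expand Γ bs) (next Γ + toℕ i) ≡ dec (bs i)
    expand-dec i = trans (expand-layout Γ bs _) (layout-dec i)

    expand-arg : ∀ j → cell (expand Γ bs) (next Γ + n + toℕ j) ≡ call (callArgs (next Γ) bs j)
    expand-arg j = trans (expand-layout Γ bs _) (layout-arg j)

    expand-outer : cell (expand Γ bs) (outerAddr Γ) ≡ call (λ i → next Γ + n + toℕ i)
    expand-outer = trans (expand-layout Γ bs _) layout-outer

  expand-extends : ∀ {Γ D bs w} → D ⊨ Γ → (∀ i → bs i < next Γ) → (∀ i → D (bs i) ≡ w i) →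
                   Extends Γ D (expand Γ bs) (expandDen (next Γ) D w)
  expand-extends {Γ} {D} {bs} {w} ⊨Γ bs< D∘bs≗w = record
    { models   = models′
    ; next≤    = ≤-trans (≤-trans (m≤m+n p n) (m≤m+n (p + n) n)) (n≤1+n _)
    ; den-old  = λ _ → expandDen-old p D w
    ; cell-old = λ _ b<p → inj₁ (expand-old Γ bs b<p)
    }
    where
    p = next Γ
    D' = expandDen p D w
    D'∘bs≗w : ∀ i → D' (bs i) ≡ w i
    D'∘bs≗w i = trans (expandDen-old p D w (bs< i)) (D∘bs≗w i)
    models′ : D' ⊨ expand Γ bs
    models′ b b≤ with region p (s≤s⁻¹ b≤)
    ... | old b<p = subst (Denotes D' b) (sym (expand-old Γ bs b<p))
                      (denotes-mono (cell Γ b) (λ a a≤b → expandDen-old p D w (≤-<-trans a≤b b<p))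
                                    (⊨Γ b b<p))
    ... | decs i refl = subst (Denotes D' _) (sym (expand-dec Γ bs i))
                      (<-≤-trans (bs< i) (m≤m+n p (toℕ i)) ,
                       trans (expandDen-dec p D w i) (cong (_- 1ℤ) (sym (D'∘bs≗w i))))
    ... | args j refl = subst (Denotes D' _) (sym (expand-arg Γ bs j))
                      (args< , trans (expandDen-arg p D w j) (tarai-cong σr≗))
      where
      args< : ∀ i → callArgs p bs j i < p + n + toℕ j
      args< zero    = <-≤-trans (+-monoʳ-< p (Finₚ.toℕ<n j)) (m≤m+n (p + n) (toℕ j))
      args< (suc i) = <-≤-trans (bs< _) (≤-trans (m≤m+n p n) (m≤m+n (p + n) (toℕ j)))
      σr≗ : ∀ i → σr j w i ≡ D' (callArgs p bs j i)
      σr≗ zero    = sym (expandDen-dec p D w j)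
      σr≗ (suc i) = sym (D'∘bs≗w _)
    ... | outer refl = subst (Denotes D' _) (sym (expand-outer Γ bs))
                      ((λ i → +-monoʳ-< (p + n) (Finₚ.toℕ<n i)) ,
                       trans (expandDen-outer p D w) (tarai-cong λ i → sym (expandDen-arg p D w i)))

  expand-extends-after : ∀ {Γ D Γ₂ D₂ bs} → Extends Γ D Γ₂ D₂ → (∀ i → bs i < next Γ) →
                         Extends Γ₂ D₂ (expand Γ₂ bs) (expandDen (next Γ₂) D₂ (D ∘ bs))
  expand-extends-after ext bs< =
    expand-extends (models ext) (λ i → <-≤-trans (bs< i) (next≤ ext)) (λ i → den-old ext _ (bs< i))

  ⇓-sound-args : ∀ {Γ D bs u w Γ₁ Γ₂} → D ⊨ Γ → (∀ i → bs i < next Γ) →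
                 Γ ⊢ bs i₁ ⇓ u ⊣ Γ₁ → Γ₁ ⊢ bs i₂ ⇓ w ⊣ Γ₂ →
                 u ≡ D (bs i₁) × w ≡ D (bs i₂) × ∃ λ D₂ → Extends Γ D Γ₂ D₂

  ⇓-sound : ∀ {Γ D a v Δ} → D ⊨ Γ → a < next Γ → Γ ⊢ a ⇓ v ⊣ Δ →
            v ≡ D a × ∃ λ D' → Extends Γ D Δ D'
  ⇓-sound {D = D} ⊨Γ a< (⇓val c≡) = sym (denotes ⊨Γ a< c≡) , D , extends-refl ⊨Γ
  ⇓-sound {D = D} {a} ⊨Γ a< (⇓dec {v = v} c≡ d) with denotes ⊨Γ a< c≡
  ... | b<a , Da≡ with ⇓-sound ⊨Γ (<-trans b<a a<) d
  ...   | v≡Db , D' , ext = v-1≡Da , D' , extends-update ext a< v-1≡Da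
    where
    v-1≡Da : v - 1ℤ ≡ D a
    v-1≡Da = trans (cong (_- 1ℤ) v≡Db) (sym Da≡)
  ⇓-sound {D = D} {a} ⊨Γ a< (⇓le {bs = bs} {w = w} c≡ d₁ d₂ u≤w)
    with ⇓-sound-args {bs = bs} ⊨Γ (call-args< ⊨Γ a< c≡) d₁ d₂
  ... | u≡ , w≡ , D₂ , ext = w≡Da , D₂ , extends-update ext a< w≡Da
    where
    w≡Da : w ≡ D a
    w≡Da = trans w≡ (sym (trans (proj₂ (denotes ⊨Γ a< c≡))
                                (tarai-≤ (D ∘ bs) (subst₂ ℤ._≤_ u≡ w≡ u≤w))))
  ⇓-sound {D = D} {a} ⊨Γ a< (⇓gt {Γ₂ = Γ₂} {bs = bs} {v = v} c≡ d₁ d₂ w<u d₃) with call-args< ⊨Γ a< c≡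
  ... | bs< with ⇓-sound-args {bs = bs} ⊨Γ bs< d₁ d₂
  ... | u≡ , w≡ , D₂ , ext₂ with expand-extends-after ext₂ bs<
  ... | ext₃ with ⇓-sound (models ext₃) (n<1+n _) d₃
  ... | v≡ , D' , ext = v≡Da , D' , extends-update (extends-trans ext₂ (extends-trans ext₃ ext)) a< v≡Da
    where
    open ≡-Reasoning
    v≡Da : v ≡ D a
    v≡Da = begin
      v                                              ≡⟨ v≡ ⟩
      expandDen (next Γ₂) D₂ (D ∘ bs) (outerAddr Γ₂) ≡⟨ expandDen-outer (next Γ₂) D₂ (D ∘ bs) ⟩
      tarai (inner (D ∘ bs))                         ≡⟨ tarai-> (D ∘ bs) (subst₂ ℤ._<_ w≡ u≡ w<u) ⟨
      tarai (D ∘ bs)                                 ≡⟨ proj₂ (denotes ⊨Γ a< c≡) ⟨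
      D a                                            ∎

  ⇓-sound-args ⊨Γ bs< d₁ d₂ with ⇓-sound ⊨Γ (bs< i₁) d₁
  ... | u≡ , D₁ , ext₁ with ⇓-sound (models ext₁) (<-≤-trans (bs< i₂) (next≤ ext₁)) d₂
  ...   | w≡ , D₂ , ext₂ = u≡ , trans w≡ (den-old ext₁ _ (bs< i₂)) , D₂ , extends-trans ext₁ ext₂

  -- Termination

  Terminates : Heap → ℕ → Set
  Terminates Γ a = ∃₂ λ v Δ → Γ ⊢ a ⇓ v ⊣ Δ

  -- An argument may be forced only after other thunks have been evaluated.
  Forceable : Heap → Den → ℕ → Set
  Forceable Γ D a = ∀ {Γ' D'} → Extends Γ D Γ' D' → Terminates Γ' a

  forceable-mono : ∀ {Γ D Γ' D' a} → Extends Γ D Γ' D' → Forceable Γ D a → Forceable Γ' D' a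
  forceable-mono ext force ext' = force (extends-trans ext ext')

  forceable-unchanged : ∀ {Γ D a} → a < next Γ →
    (∀ {Γ' D'} → Extends Γ D Γ' D' → cell Γ' a ≡ cell Γ a → Terminates Γ' a) → Forceable Γ D a
  forceable-unchanged a< force ext with cell-old ext _ a<
  ... | inj₁ unchanged = force ext unchanged
  ... | inj₂ evaluated = _ , _ , ⇓val evaluated

  force-args : ∀ {Γ D cs} → D ⊨ Γ → (∀ i → cs i < next Γ) →
               Forceable Γ D (cs i₁) → Forceable Γ D (cs i₂) →
               ∃₂ λ Γ₁ Γ₂ → Γ ⊢ cs i₁ ⇓ D (cs i₁) ⊣ Γ₁ × Γ₁ ⊢ cs i₂ ⇓ D (cs i₂) ⊣ Γ₂ ×
                            ∃ (Extends Γ D Γ₂)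
  force-args {cs = cs} ⊨Γ cs< force₁ force₂ with force₁ (extends-refl ⊨Γ)
  ... | _ , Γ₁ , d₁ with ⇓-sound ⊨Γ (cs< i₁) d₁
  ... | refl , _ , ext₁ with force₂ ext₁
  ... | _ , Γ₂ , d₂ with ⇓-sound-args {bs = cs} ⊨Γ cs< d₁ d₂
  ... | _ , refl , ext = Γ₁ , Γ₂ , d₁ , d₂ , ext

  Callable : ℤⁿ → Set
  Callable w = ∀ {Γ D c cs} → D ⊨ Γ → c < next Γ → cell Γ c ≡ call cs →
               (∀ i → D (cs i) ≡ w i) →
               (∀ i → toℕ i ≤ suc (run w) → Forceable Γ D (cs i)) → Terminates Γ c

  expand-terminates : ∀ {Γ D cs w} → D ⊨ Γ → (∀ i → cs i < next Γ) → (∀ i → D (cs i) ≡ w i) →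
    (∀ i → toℕ i ≤ suc (run w) → Forceable Γ D (cs i)) →
    w i₂ ℤ.< w i₁ → Callable (inner w) → (∀ j → toℕ j ≤ run w → Callable (σr j w)) →
    Terminates (expand Γ cs) (outerAddr Γ)
  expand-terminates {Γ} {D} {cs} {w} ⊨Γ cs< D∘cs≗w force w₂<w₁ callable-inner callable-σr =
    callable-inner (models ext₃) (n<1+n _) (expand-outer Γ cs) (expandDen-arg p D w)
                   (λ j j≤ → forceable-unchanged (arg< j) (call-arg j (≤-trans j≤ (run-inner< w w₂<w₁))))
    where
    p = next Γ
    Γ₃ = expand Γ cs
    D₃ = expandDen p D w
    ext₃ : Extends Γ D Γ₃ D₃
    ext₃ = expand-extends ⊨Γ cs< D∘cs≗w
    dec< : ∀ j → p + toℕ j < next Γ₃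
    dec< j = <-≤-trans (+-monoʳ-< p (Finₚ.toℕ<n j)) (≤-trans (m≤m+n (p + n) n) (n≤1+n _))
    arg< : ∀ j → p + n + toℕ j < next Γ₃
    arg< j = <-≤-trans (+-monoʳ-< (p + n) (Finₚ.toℕ<n j)) (n≤1+n _)

    forceable-dec : ∀ j → toℕ j ≤ suc (run w) → Forceable Γ₃ D₃ (p + toℕ j)
    forceable-dec j j≤ = forceable-unchanged (dec< j) λ ext unchanged →
      let (_ , _ , d) = force j j≤ (extends-trans ext₃ ext)
      in _ , _ , ⇓dec (trans unchanged (expand-dec Γ cs j)) d

    call-arg : ∀ j → toℕ j ≤ run w → ∀ {Γ' D'} → Extends Γ₃ D₃ Γ' D' →
               cell Γ' (p + n + toℕ j) ≡ cell Γ₃ (p + n + toℕ j) → Terminates Γ' (p + n + toℕ j)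
    call-arg j j≤ {Γ'} {D'} ext unchanged =
      callable-σr j j≤ (models ext) (<-≤-trans (arg< j) (next≤ ext)) (trans unchanged (expand-arg Γ cs j))
                  D'∘args≗σr forceable-args
      where
      D'∘args≗σr : ∀ i → D' (callArgs p cs j i) ≡ σr j w i
      D'∘args≗σr zero    = trans (den-old ext _ (dec< j)) (expandDen-dec p D w j)
      D'∘args≗σr (suc i) = trans (den-old ext _ (<-≤-trans (cs< _) (next≤ ext₃)))
                                 (trans (expandDen-old p D w (cs< _)) (D∘cs≗w _))
      forceable-args : ∀ i → toℕ i ≤ suc (run (σr j w)) → Forceable Γ' D' (callArgs p cs j i)
      forceable-args zero    _   = forceable-mono ext (forceable-dec j (m≤n⇒m≤1+n j≤))
      forceable-args (suc i) i≤ = forceable-mono (extends-trans ext₃ ext) (force _ (rotIdx-needed i j≤ i≤))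

  callable : ∀ w → Callable w
  callable = tarai-ind Callable step
    where
    step : ∀ w → (w i₂ ℤ.< w i₁ → Callable (inner w) × (∀ j → toℕ j ≤ run w → Callable (σr j w))) →
           Callable w
    step w ih {cs = cs} ⊨Γ c< c≡ D∘cs≗w force with call-args< ⊨Γ c< c≡
    ... | cs< with force-args {cs = cs} ⊨Γ cs< (force i₁ z≤n) (force i₂ (s≤s z≤n))
                 | ≤⊎> (w i₁) (w i₂)
    ...   | _ , _ , d₁ , d₂ , _ | inj₁ w₁≤w₂ =
      _ , _ , ⇓le c≡ d₁ d₂ (subst₂ ℤ._≤_ (sym (D∘cs≗w i₁)) (sym (D∘cs≗w i₂)) w₁≤w₂)
    ...   | _ , _ , d₁ , d₂ , _ , ext | inj₂ w₂<w₁ =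
      let (_ , _ , d₃) = expand-terminates {w = w} (models ext) (λ i → <-≤-trans (cs< i) (next≤ ext))
                           (λ i → trans (den-old ext _ (cs< i)) (D∘cs≗w i))
                           (λ i i≤ → forceable-mono ext (force i i≤))
                           w₂<w₁ (proj₁ (ih w₂<w₁)) (proj₂ (ih w₂<w₁))
      in _ , _ , ⇓gt c≡ d₁ d₂ (subst₂ ℤ._<_ (sym (D∘cs≗w i₂)) (sym (D∘cs≗w i₁)) w₂<w₁) d₃

  terminates : ∀ a {Γ D} → D ⊨ Γ → a < next Γ → Terminates Γ a
  terminates = <-rec (λ a → ∀ {Γ D} → D ⊨ Γ → a < next Γ → Terminates Γ a) step
    where
    step : ∀ a → (∀ {b} → b < a → ∀ {Γ D} → D ⊨ Γ → b < next Γ → Terminates Γ b) →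
           ∀ {Γ D} → D ⊨ Γ → a < next Γ → Terminates Γ a
    step a ih {Γ} {D} ⊨Γ a< with cell Γ a in c≡
    ... | val _ = _ , _ , ⇓val c≡
    ... | dec b =
      let b<a = proj₁ (denotes ⊨Γ a< c≡)
          (_ , _ , d) = ih b<a ⊨Γ (<-trans b<a a<)
      in _ , _ , ⇓dec c≡ d
    ... | call bs = callable (D ∘ bs) ⊨Γ a< c≡ (λ _ → refl) λ i _ ext →
      let bs<a = proj₁ (denotes ⊨Γ a< c≡) i
      in ih bs<a (models ext) (<-≤-trans (<-trans bs<a a<) (next≤ ext))

  initDen : ℤⁿ → Den
  initDen x b = if b ≡ᵇ n then tarai x else blk 0 x (λ _ → 0ℤ) b

  initDen-root : ∀ x → initDen x rootAddr ≡ tarai x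
  initDen-root x = if-≡ᵇ-refl n

  initDen-arg : ∀ x i → initDen x (toℕ i) ≡ x i
  initDen-arg x i = trans (if-≡ᵇ-≢ (<⇒≢ (Finₚ.toℕ<n i))) (blk-at 0 x _ i)

  initHeap-arg : ∀ x i → cell (initHeap x) (toℕ i) ≡ val (x i)
  initHeap-arg x i = trans (if-≡ᵇ-≢ (<⇒≢ (Finₚ.toℕ<n i)))
                           (trans (block≡blk {0} {val ∘ x} {λ _ → val 0ℤ} {λ _ → val 0ℤ} {toℕ i} refl)
                                  (blk-at 0 (val ∘ x) (λ _ → val 0ℤ) i))

  init-models : ∀ x → initDen x ⊨ initHeap x
  init-models x b b≤n with b ℕₚ.≟ n
  ... | yes refl = subst (Denotes (initDen x) n) (sym (if-≡ᵇ-refl n))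
                     (Finₚ.toℕ<n , trans (initDen-root x) (tarai-cong λ i → sym (initDen-arg x i)))
  ... | no b≢n = subst (λ b → Denotes (initDen x) b (cell (initHeap x) b)) (Finₚ.toℕ-fromℕ< b<n)
                   (subst (Denotes (initDen x) _) (sym (initHeap-arg x i)) (initDen-arg x i))
    where
    b<n : b < n
    b<n = ≤∧≢⇒< (s≤s⁻¹ b≤n) b≢n
    i = fromℕ< b<n

open import Data.Integer using (ℤ; _≤_)

theorem1p2 : (m : ℕ) → let open Tarai (suc m) in
    (x : Fin n → ℤ) →
    (∃ λ v → ∃ λ Δ → initHeap x ⊢ rootAddr ⇓ v ⊣ Δ) ×
    (∀ v Δ → initHeap x ⊢ rootAddr ⇓ v ⊣ Δ → v ≤ maxv x)
theorem1p2 m x =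
  terminates rootAddr (init-models x) root< , λ v Δ d → subst (_≤ maxv x) (sym (value d)) (tarai≤maxv x)
  where
  open TaraiFunction m
  open CallByNeed m
  root< : rootAddr ℕ.< next (initHeap x)
  root< = ℕₚ.n<1+n n
  value : ∀ {v Δ} → initHeap x ⊢ rootAddr ⇓ v ⊣ Δ → v ≡ tarai x
  value d = trans (proj₁ (⇓-sound (init-models x) root< d)) (initDen-root x)
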